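{- Let $p>2$ be a prime, let $r\ge 2$ be an integer, and put $t=v(r-1)\ge 0$. Then (1) for all integers $n\ge 2$, $v\left(\binom{r}{n}\right)+n\ge t+2$; and (2) for all integers $n\ge 1$, $v\left(\binom{r-1}{n}\right)+n\ge t+1$.
   Context: $v$ denotes the $p$-adic valuation normalised by $v(p)=1$, with $v(0)=+\infty$. -}

module Defs where

open import Data.Nat using (ℕ; suc; _^_)
open import Data.Nat.Divisibility using (_∣_)
open import Data.Product using (_×_)
open import Relation.Nullary using (¬_)

-- IsVal p m k  means  v_p(m) = k  (k finite).  For m = 0 no k satisfies it,
-- matching the convention v(0) = +∞.
IsVal : ℕ → ℕ → ℕ → Set
IsVal p m k = (p ^ k ∣ m) × ¬ (p ^ suc k ∣ m)

{-# OPTIONS --safe #-}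
-- The absorption identity n·C(r−1,n) = (r−1)·C(r−2,n−1) gives p^t ∣ n·C(r−1,n)
-- and, used twice, p^t ∣ (n−1)n·C(r,n). If the binomial coefficient has
-- valuation k, then p^(t−k) divides n, resp. (n−1)n, and hence n or n−1, since p
-- cannot divide both of two consecutive numbers. For j ≥ 1 a positive multiple of
-- p^j is at least p^j ≥ p + j − 1, which is ≥ j + 1, and ≥ j + 2 when p ≥ 3.
module Submission where

open import Defs
open import Data.Nat using (ℕ; _+_; _∸_; _≤_; _<_)
open import Data.Nat.Primality using (Prime)
open import Data.Nat.Combinatorics using (_C_)
open import Data.Product using (_×_)

open import Data.Nat.Base using (zero; suc; _*_; _^_; z≤n; s≤s; NonZero; >-nonZero⁻¹; nonTrivial⇒≢1)
open import Data.Nat.Properties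
open import Data.Nat.Divisibility
open import Data.Nat.Combinatorics using (nC1≡n; nCk+nC[k+1]≡[n+1]C[k+1])
open import Data.Nat.Primality using (euclidsLemma; prime⇒nonZero)
open import Data.Nat.Tactic.RingSolver using (solve-∀)
open import Data.Product using (_,_)
open import Data.Sum using (_⊎_; inj₁; inj₂; [_,_]′)
open import Relation.Nullary using (¬_; yes; no; contradiction)
open import Relation.Binary.PropositionalEquality

[1+k]*[1+n]C[1+k]≡[1+n]*nCk : ∀ n k → suc k * (suc n C suc k) ≡ suc n * (n C k)
[1+k]*[1+n]C[1+k]≡[1+n]*nCk zero    zero    = refl
[1+k]*[1+n]C[1+k]≡[1+n]*nCk zero    (suc k) = *-zeroʳ (suc (suc k))
[1+k]*[1+n]C[1+k]≡[1+n]*nCk (suc n) zero    =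
  trans (*-identityˡ _) (trans (nC1≡n (suc (suc n))) (sym (*-identityʳ _)))
[1+k]*[1+n]C[1+k]≡[1+n]*nCk (suc n) (suc k) = begin
  (2 + k) * (suc (suc n) C suc (suc k))  ≡⟨ cong ((2 + k) *_) (sym (nCk+nC[k+1]≡[n+1]C[k+1] (suc n) (suc k))) ⟩
  (2 + k) * (a + b)                      ≡⟨ expand k a b ⟩
  (1 + k) * a + a + (2 + k) * b          ≡⟨ cong₂ (λ u v → u + a + v) ([1+k]*[1+n]C[1+k]≡[1+n]*nCk n k)
                                                                    ([1+k]*[1+n]C[1+k]≡[1+n]*nCk n (suc k)) ⟩
  (1 + n) * (n C k) + a + (1 + n) * (n C suc k)
                                         ≡⟨ collect n a (n C k) (n C suc k) ⟩
  (1 + n) * (n C k + n C suc k) + a      ≡⟨ cong (λ u → (1 + n) * u + a) (nCk+nC[k+1]≡[n+1]C[k+1] n k) ⟩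
  (1 + n) * a + a                        ≡⟨ absorb n a ⟩
  (2 + n) * a                            ∎
  where
  open ≡-Reasoning
  a = suc n C suc k
  b = suc n C suc (suc k)
  expand : ∀ k a b → (2 + k) * (a + b) ≡ (1 + k) * a + a + (2 + k) * b
  expand = solve-∀
  collect : ∀ n a c d → (1 + n) * c + a + (1 + n) * d ≡ (1 + n) * (c + d) + a
  collect = solve-∀
  absorb : ∀ n a → (1 + n) * a + a ≡ (2 + n) * a
  absorb = solve-∀

[1+n]*[2+n]*[2+r]C[2+n]≡[2+r]*[1+r]*rCn : ∀ r n →
  suc n * suc (suc n) * (suc (suc r) C suc (suc n)) ≡ suc (suc r) * (suc r * (r C n))
[1+n]*[2+n]*[2+r]C[2+n]≡[2+r]*[1+r]*rCn r n = begin
  suc n * suc (suc n) * (suc (suc r) C suc (suc n))  ≡⟨ *-assoc (suc n) (suc (suc n)) (suc (suc r) C suc (suc n)) ⟩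
  suc n * (suc (suc n) * (suc (suc r) C suc (suc n))) ≡⟨ cong (suc n *_) ([1+k]*[1+n]C[1+k]≡[1+n]*nCk (suc r) (suc n)) ⟩
  suc n * (suc (suc r) * (suc r C suc n))           ≡⟨ x∙yz≈y∙xz (suc n) (suc (suc r)) (suc r C suc n) ⟩
  suc (suc r) * (suc n * (suc r C suc n))           ≡⟨ cong (suc (suc r) *_) ([1+k]*[1+n]C[1+k]≡[1+n]*nCk r n) ⟩
  suc (suc r) * (suc r * (r C n))                   ∎
  where
  open ≡-Reasoning
  open import Algebra.Properties.CommutativeSemigroup *-commutativeSemigroup using (x∙yz≈y∙xz)

^-monoʳ-∣ : ∀ m {i j} → i ≤ j → m ^ i ∣ m ^ j
^-monoʳ-∣ m {i} {j} i≤j =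
  divides (m ^ (j ∸ i)) (begin
    m ^ j                 ≡⟨ cong (m ^_) (m+[n∸m]≡n i≤j) ⟨
    m ^ (i + (j ∸ i))     ≡⟨ ^-distribˡ-+-* m i (j ∸ i) ⟩
    m ^ i * m ^ (j ∸ i)   ≡⟨ *-comm (m ^ i) _ ⟩
    m ^ (j ∸ i) * m ^ i   ∎)
  where open ≡-Reasoning

m+n≤m^[1+n] : ∀ {m} → 1 < m → ∀ n → m + n ≤ m ^ suc n
m+n≤m^[1+n] {m} _ zero = ≤-reflexive (trans (+-identityʳ m) (sym (*-identityʳ m)))
m+n≤m^[1+n] {m@(suc _)} 1<m (suc n) = begin
  m + suc n          ≡⟨ +-suc m n ⟩
  suc (m + n)        ≤⟨ s≤s (m+n≤m^[1+n] 1<m n) ⟩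
  suc (m ^ suc n)    ≤⟨ m<m*n (m ^ suc n) m {{m^n≢0 m (suc n)}} 1<m ⟩
  m ^ suc n * m      ≡⟨ *-comm (m ^ suc n) m ⟩
  m ^ suc (suc n)    ∎
  where open ≤-Reasoning

^∣⇒< : ∀ {m a} j → 1 < m → .{{NonZero a}} → m ^ j ∣ a → j < a
^∣⇒< {a = a} zero    _   _      = >-nonZero⁻¹ a
^∣⇒< {m}     (suc i) 1<m m^j∣a =
  ≤-trans (+-monoˡ-≤ i 1<m) (≤-trans (m+n≤m^[1+n] 1<m i) (∣⇒≤ m^j∣a))

c+[t∸k]≤n⇒t+c≤k+n : ∀ c t k n → c + (t ∸ k) ≤ n → t + c ≤ k + n
c+[t∸k]≤n⇒t+c≤k+n c t k n c+[t∸k]≤n = begin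
  t + c              ≤⟨ +-monoˡ-≤ c (m≤n+m∸n t k) ⟩
  k + (t ∸ k) + c    ≡⟨ +-assoc k (t ∸ k) c ⟩
  k + ((t ∸ k) + c)  ≡⟨ cong (k +_) (+-comm (t ∸ k) c) ⟩
  k + (c + (t ∸ k))  ≤⟨ +-monoʳ-≤ k c+[t∸k]≤n ⟩
  k + n              ∎
  where open ≤-Reasoning

module _ {p : ℕ} (p-prime : Prime p) where

  private
    open Prime p-prime using (nontrivial)
    instance
      p≢0 : NonZero p
      p≢0 = prime⇒nonZero p-prime

  ^∣*-cancelʳ : ∀ t {x y} → ¬ p ∣ y → p ^ t ∣ x * y → p ^ t ∣ x
  ^∣*-cancelʳ zero    _   _ = 1∣ _
  ^∣*-cancelʳ (suc t) {x} {y} p∤y p^[1+t]∣xy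
    with euclidsLemma x y p-prime (∣-trans (m∣m*n (p ^ t)) p^[1+t]∣xy)
  ... | inj₂ p∣y = contradiction p∣y p∤y
  ... | inj₁ (divides-refl q) =
    ∣-trans (*-monoʳ-∣ p (^∣*-cancelʳ t p∤y (*-cancelˡ-∣ p (∣-trans p^[1+t]∣xy (∣-reflexive reassoc)))))
            (∣-reflexive (*-comm p q))
    where
    reassoc : q * p * y ≡ p * (q * y)
    reassoc = trans (cong (_* y) (*-comm q p)) (*-assoc p q y)

  ^∣*∧^∤⇒^∸∣ : ∀ k t {x y} → p ^ t ∣ x * y → ¬ p ^ suc k ∣ y → p ^ (t ∸ k) ∣ x
  ^∣*∧^∤⇒^∸∣ k t {y = y} p^t∣xy p^[1+k]∤y with p ∣? y
  ... | no p∤y = ∣-trans (^-monoʳ-∣ p (m∸n≤m t k)) (^∣*-cancelʳ t p∤y p^t∣xy)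
  ^∣*∧^∤⇒^∸∣ zero    t       _ p^1∤y | yes p∣y =
    contradiction (∣-trans (∣-reflexive (*-identityʳ p)) p∣y) p^1∤y
  ^∣*∧^∤⇒^∸∣ (suc k) zero    _ _     | yes _   = 1∣ _
  ^∣*∧^∤⇒^∸∣ (suc k) (suc t) {x} p^[1+t]∣xy p^[2+k]∤y | yes (divides-refl q) =
    ^∣*∧^∤⇒^∸∣ k t (*-cancelˡ-∣ p (∣-trans p^[1+t]∣xy (∣-reflexive reassoc)))
      (λ p^[1+k]∣q → p^[2+k]∤y (∣-trans (*-monoʳ-∣ p p^[1+k]∣q) (∣-reflexive (*-comm p q))))
    where
    reassoc : x * (q * p) ≡ p * (x * q)
    reassoc = trans (sym (*-assoc x q p)) (*-comm (x * q) p)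

  ^∣-consecutive : ∀ j m → p ^ j ∣ m * suc m → p ^ j ∣ m ⊎ p ^ j ∣ suc m
  ^∣-consecutive j m p^j∣m[1+m] with p ∣? m
  ... | no p∤m  = inj₂ (^∣*-cancelʳ j p∤m (∣-trans p^j∣m[1+m] (∣-reflexive (*-comm m (suc m)))))
  ... | yes p∣m = inj₁ (^∣*-cancelʳ j p∤1+m p^j∣m[1+m])
    where
    p∤1+m : ¬ p ∣ suc m
    p∤1+m p∣1+m = nonTrivial⇒≢1 (∣1⇒≡1 (∣m+n∣m⇒∣n (subst (p ∣_) (+-comm 1 m) p∣1+m) p∣m))

  ^∣[1+m]*[2+m]⇒2+j≤2+m : 2 < p → ∀ j m → p ^ j ∣ suc m * suc (suc m) → 2 + j ≤ suc (suc m)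
  ^∣[1+m]*[2+m]⇒2+j≤2+m _   zero    m _ = s≤s (s≤s z≤n)
  ^∣[1+m]*[2+m]⇒2+j≤2+m 2<p (suc i) m p^j∣[1+m][2+m] =
    ≤-trans 3+i≤p^j
      ([ (λ p^j∣1+m → m≤n⇒m≤1+n (∣⇒≤ p^j∣1+m)) , ∣⇒≤ ]′ (^∣-consecutive (suc i) (suc m) p^j∣[1+m][2+m]))
    where
    3+i≤p^j : 3 + i ≤ p ^ suc i
    3+i≤p^j = ≤-trans (+-monoˡ-≤ i 2<p) (m+n≤m^[1+n] (<-trans (s≤s (s≤s z≤n)) 2<p) i)

lemma2p1 : (p r t : ℕ) → Prime p → 2 < p → 2 ≤ r → IsVal p (r ∸ 1) t →
    ((n k : ℕ) → 2 ≤ n → IsVal p (r C n) k → t + 2 ≤ k + n)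
    × ((n k : ℕ) → 1 ≤ n → IsVal p ((r ∸ 1) C n) k → t + 1 ≤ k + n)
lemma2p1 p zero          t _       _   () _
lemma2p1 p (suc zero)    t _       _   (s≤s ()) _
lemma2p1 p (suc (suc r)) t p-prime 2<p _ (p^t∣1+r , _) = part₁ , part₂
  where
  part₁ : (n k : ℕ) → 2 ≤ n → IsVal p (suc (suc r) C n) k → t + 2 ≤ k + n
  part₁ zero          _ () _
  part₁ (suc zero)    _ (s≤s ()) _
  part₁ (suc (suc n)) k _ (_ , p^[1+k]∤C) =
    c+[t∸k]≤n⇒t+c≤k+n 2 t k (suc (suc n))
      (^∣[1+m]*[2+m]⇒2+j≤2+m p-prime 2<p (t ∸ k) n (^∣*∧^∤⇒^∸∣ p-prime k t p^t∣[1+n][2+n]C p^[1+k]∤C))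
    where
    p^t∣[1+n][2+n]C : p ^ t ∣ suc n * suc (suc n) * (suc (suc r) C suc (suc n))
    p^t∣[1+n][2+n]C = subst (p ^ t ∣_) (sym ([1+n]*[2+n]*[2+r]C[2+n]≡[2+r]*[1+r]*rCn r n))
                        (∣-trans p^t∣1+r (∣-trans (m∣m*n (r C n)) (n∣m*n (suc (suc r)))))
  part₂ : (n k : ℕ) → 1 ≤ n → IsVal p (suc r C n) k → t + 1 ≤ k + n
  part₂ zero    _ () _
  part₂ (suc n) k _ (_ , p^[1+k]∤C) =
    c+[t∸k]≤n⇒t+c≤k+n 1 t k (suc n)
      (^∣⇒< (t ∸ k) (<-trans (s≤s (s≤s z≤n)) 2<p) (^∣*∧^∤⇒^∸∣ p-prime k t p^t∣[1+n]C p^[1+k]∤C))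
    where
    p^t∣[1+n]C : p ^ t ∣ suc n * (suc r C suc n)
    p^t∣[1+n]C = subst (p ^ t ∣_) (sym ([1+k]*[1+n]C[1+k]≡[1+n]*nCk r n)) (∣-trans p^t∣1+r (m∣m*n (r C n)))
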